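{- There exists a feasible set $B$ that is a basis of $W$ and contains all singletons, i.e., $\{\mathbf{t}\mid t\in T\}\subseteq B$.
   Context: Let $G=(V,E)$ be a finite simple connected undirected graph, $T\subseteq V$ a set of terminals with $|T|=k$, $|V|=n$, and $\mathcal{S}$ a partition of $T$ into non-empty blocks with $|\mathcal{S}|\ge 2$. Let $q$ be the least prime with $|\mathcal{S}|<q\le 2|\mathcal{S}|$, and let $\theta:T\to\mathbb{F}_q$ satisfy $\theta(t)=\theta(t')$ iff $t,t'$ lie in the same block. For each edge $e\in E$ fix a bijection $\mu_e:e\to\{1,-1\}\subseteq\mathbb{F}_q$. Let $W$ be the $(2n-k)$-dimensional $\mathbb{F}_q$-vector space with basis consisting of a vector $\mathbf{t}$ (a "singleton") for each $t\in T$ and two vectors $\mathbf{v}^\circ,\mathbf{v}^\bullet$ for each $v\in V\setminus T$. For $t\in T$ set $\mathbf{t}^\circ:=\mathbf{t}$, $\mathbf{t}^\bullet:=\theta(t)\mathbf{t}$. For each edge $e=\{u,v\}$ set $\mathbf{e}^\circ:=\mu_e(u)\mathbf{u}^\circ+\mu_e(v)\mathbf{v}^\circ$, $\mathbf{e}^\bullet:=\mu_e(u)\mathbf{u}^\bullet+\mu_e(v)\mathbf{v}^\bullet$, and call $\ell_e=\{\mathbf{e}^\circ,\mathbf{e}^\bullet\}$ a line. A set of vectors is feasible if it is of the form $\{\mathbf{t}\mid t\in S\}\cup\{\mathbf{e}^\circ,\mathbf{e}^\bullet\mid e\in F\}$ for some $S\subseteq T$ and $F\subseteq E$. -}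

module Defs where

open import Data.Nat using (ℕ; _+_; _*_; _∸_; NonZero)
open import Data.Nat.DivMod using (_mod_)
open import Data.Fin using (Fin; toℕ)
open import Data.Fin.Subset using (Subset; _∈_)
open import Data.Vec using (lookup)
open import Data.Bool using (Bool; true; false; if_then_else_)
open import Data.Product using (_×_; Σ; ∃; _,_; proj₁; proj₂)
open import Data.Sum using (_⊎_)
open import Data.List using (List; []; _∷_)
open import Data.List.Relation.Unary.All using (All)
open import Data.List.Relation.Unary.AllPairs using (AllPairs)
open import Relation.Binary.PropositionalEquality using (_≡_; _≢_)
open import Relation.Nullary using (¬_)

-- An edge is an unordered pair; the listing order of its two ends is
-- irrelevant (the sign choice σ below fixes μ_e independently).

SameEdge : ∀ {n} → Fin n × Fin n → Fin n × Fin n → Set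
SameEdge (a , b) (c , d) = (a ≡ c × b ≡ d) ⊎ (a ≡ d × b ≡ c)

record Graph (n : ℕ) : Set where
  field
    m        : ℕ
    ends     : Fin m → Fin n × Fin n
    loopless : ∀ i → proj₁ (ends i) ≢ proj₂ (ends i)
    noMulti  : ∀ i j → SameEdge (ends i) (ends j) → i ≡ j

module _ {n : ℕ} (G : Graph n) where
  open Graph G

  data Reach : Fin n → Fin n → Set where
    here  : ∀ {v} → Reach v v
    fwd   : ∀ {u} (i : Fin m) → Reach (proj₂ (ends i)) u → Reach (proj₁ (ends i)) u
    bwd   : ∀ {u} (i : Fin m) → Reach (proj₁ (ends i)) u → Reach (proj₂ (ends i)) u

  Connected : Set
  Connected = ∀ u v → Reach u v

module Field (q : ℕ) ⦃ _ : NonZero q ⦄ where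
  F : Set
  F = Fin q

  _⊕_ : F → F → F
  a ⊕ b = (toℕ a + toℕ b) mod q

  _⊗_ : F → F → F
  a ⊗ b = (toℕ a * toℕ b) mod q

  0F 1F -1F : F
  0F = 0 mod q
  1F = 1 mod q
  -1F = (q ∸ 1) mod q

-- Coordinates are indexed by (v , c) with c ∈ {∘,•}; the
-- basis vectors are v° = (v,∘), v• = (v,•) for v ∉ T and the singleton
-- t = (t,∘) for t ∈ T.

data Colour : Set where
  ∘c •c : Colour

module Space (q : ℕ) ⦃ _ : NonZero q ⦄ (n : ℕ) where
  open Field q public

  Vect : Set
  Vect = Fin n → Colour → F

  zeroV : Vect
  zeroV _ _ = 0F

  _+V_ : Vect → Vect → Vect
  (x +V y) v c = x v c ⊕ y v c

  _·V_ : F → Vect → Vect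
  (a ·V x) v c = a ⊗ x v c

  _≈_ : Vect → Vect → Set
  x ≈ y = ∀ v c → x v c ≡ y v c

  unit : Fin n → Colour → Vect
  unit v c w d with v Data.Fin.≟ w | c | d
  ... | Relation.Nullary.yes _ | ∘c | ∘c = 1F
  ... | Relation.Nullary.yes _ | •c | •c = 1F
  ... | _ | _ | _ = 0F

  InW : Subset n → Vect → Set
  InW T x = ∀ t → t ∈ T → x t •c ≡ 0F

  sing : Fin n → Vect
  sing t = unit t ∘c

  vcirc : Fin n → Vect
  vcirc v = unit v ∘c

  vbul : Subset n → (Fin n → F) → Fin n → Vect
  vbul T θ v = if lookup T v then θ v ·V unit v ∘c else unit v •c

  lincomb : List (F × Vect) → Vect
  lincomb []             = zeroV
  lincomb ((a , x) ∷ xs) = (a ·V x) +V lincomb xs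

  -- B is a set of vectors (a predicate, to be read up to ≈)
  Independent : (Vect → Set) → Set
  Independent B = ∀ (xs : List (F × Vect))
    → All (λ p → B (proj₂ p)) xs
    → AllPairs (λ p p' → ¬ (proj₂ p ≈ proj₂ p')) xs
    → lincomb xs ≈ zeroV
    → All (λ p → proj₁ p ≡ 0F) xs

  Spans : Subset n → (Vect → Set) → Set
  Spans T B = ∀ w → InW T w →
    ∃ λ (xs : List (F × Vect)) → All (λ p → B (proj₂ p)) xs × lincomb xs ≈ w

  IsBasisOfW : Subset n → (Vect → Set) → Set
  IsBasisOfW T B = (∀ x → B x → InW T x) × Independent B × Spans T B

  module Edges (G : Graph n) (T : Subset n) (θ : Fin n → F)
               (σ : Fin (Graph.m G) → Bool) where
    open Graph G

    μ₁ μ₂ : Fin m → F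
    μ₁ i = if σ i then 1F else -1F
    μ₂ i = if σ i then -1F else 1F

    ecirc ebul : Fin m → Vect
    ecirc i = (μ₁ i ·V vcirc (proj₁ (ends i))) +V (μ₂ i ·V vcirc (proj₂ (ends i)))
    ebul  i = (μ₁ i ·V vbul T θ (proj₁ (ends i))) +V (μ₂ i ·V vbul T θ (proj₂ (ends i)))

    FeasibleSet : Subset n → Subset m → Vect → Set
    FeasibleSet S Fs x =
      (∃ λ t → t ∈ S × x ≈ sing t) ⊎ (∃ λ i → i ∈ Fs × (x ≈ ecirc i ⊎ x ≈ ebul i))

{-# OPTIONS --safe #-}
-- Take S = T and for F a breadth-first spanning forest rooted at the terminals, in which
-- every non-terminal v is joined by its parent edge to a neighbour closer to T.
-- B spans W: by induction on the distance to T, v° and v• are recovered from the vectors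
-- e° = ±v° ± w°, e• = ±v• ± w• of the parent edge and from those of the parent w, while
-- a terminal t has t° = t and t• = θ(t) t.  B is independent because it is triangular:
-- the two vectors of the parent edge of v are ±1 at the coordinates (v,∘) and (v,•), where
-- every other vector of B vanishes except those of the edges to children of v, and a
-- singleton t is 1 at (t,∘), where only edge vectors can be nonzero.  So the coefficients
-- of a vanishing combination vanish from the leaves of the forest upwards, singletons last.
module Submission where

open import Defs
open import Algebra.Bundles using (CommutativeSemiring)
open import Algebra.Definitions using (Associative; Commutative; LeftIdentity; LeftZero; _DistributesOverʳ_)
open import Algebra.Structures using (IsCommutativeMonoid)
import Algebra.Structures.Biased as Biased
open import Data.Bool using (Bool)
open import Data.Fin using (Fin; toℕ; fromℕ<)
open import Data.Fin.Properties using (toℕ-injective; toℕ<n; toℕ-fromℕ<; _≟_; any?)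
open import Data.Fin.Subset using (Subset; _∈_; _∉_; _⊆_)
open import Data.Fin.Subset.Properties using (_∈?_)
open import Data.Nat using (ℕ; _≤_; _<_; _+_; _*_; _∸_; _%_; NonZero; >-nonZero⁻¹; suc; zero; s≤s; z≤n)
open import Data.Nat.DivMod using (_mod_; %-distribˡ-+; %-distribˡ-*; m<n⇒m%n≡m; [m+n]%n≡m%n; m%n<n; [m+kn]%n≡m%n)
open import Data.Nat.Primality using (Prime)
import Data.Nat.Properties as ℕ
open import Data.Nat.Tactic.RingSolver using (solve-∀)
open import Data.Product using (_×_; ∃; ∃₂; _,_; proj₁; proj₂)
open import Data.Sum using (_⊎_; inj₁; inj₂)
open import Data.Vec using (tabulate)
open import Data.Vec.Properties using (lookup∘tabulate; lookup⇒[]=; []=⇒lookup)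
open import Function using (_∘_)
open import Function.Bundles using (_⇔_)
open import Level using (0ℓ)
open import Relation.Binary.PropositionalEquality
  using (_≡_; refl; sym; trans; cong; cong₂; isEquivalence; module ≡-Reasoning)
open import Relation.Nullary using (Dec; yes; no; does; contradiction)
open import Relation.Nullary.Decidable using (_×-dec_; _⊎-dec_; dec-true)
open import Relation.Unary using (Decidable)

module ModularArithmetic (q : ℕ) ⦃ _ : NonZero q ⦄ where
  open Field q

  -- Every law is transported from ℕ along ⟦_⟧, which turns + and * into ⊕ and ⊗.
  ⟦_⟧ : ℕ → F
  ⟦ x ⟧ = x mod q

  toℕ-⟦⟧ : ∀ x → toℕ ⟦ x ⟧ ≡ x % q
  toℕ-⟦⟧ x = toℕ-fromℕ< (m%n<n x q)

  ⟦⟧-cong : ∀ {x y} → x % q ≡ y % q → ⟦ x ⟧ ≡ ⟦ y ⟧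
  ⟦⟧-cong {x} {y} eq = toℕ-injective (trans (toℕ-⟦⟧ x) (trans eq (sym (toℕ-⟦⟧ y))))

  ⟦toℕ⟧ : ∀ a → ⟦ toℕ a ⟧ ≡ a
  ⟦toℕ⟧ a = toℕ-injective (trans (toℕ-⟦⟧ (toℕ a)) (m<n⇒m%n≡m (toℕ<n a)))

  ⟦⟧-+ : ∀ x y → ⟦ x ⟧ ⊕ ⟦ y ⟧ ≡ ⟦ x + y ⟧
  ⟦⟧-+ x y = trans (cong₂ (λ a b → ⟦ a + b ⟧) (toℕ-⟦⟧ x) (toℕ-⟦⟧ y)) (⟦⟧-cong (sym (%-distribˡ-+ x y q)))

  ⟦⟧-* : ∀ x y → ⟦ x ⟧ ⊗ ⟦ y ⟧ ≡ ⟦ x * y ⟧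
  ⟦⟧-* x y = trans (cong₂ (λ a b → ⟦ a * b ⟧) (toℕ-⟦⟧ x) (toℕ-⟦⟧ y)) (⟦⟧-cong (sym (%-distribˡ-* x y q)))

  ⊕-⟦⟧ : ∀ x b → ⟦ x ⟧ ⊕ b ≡ ⟦ x + toℕ b ⟧
  ⊕-⟦⟧ x b = trans (cong (⟦ x ⟧ ⊕_) (sym (⟦toℕ⟧ b))) (⟦⟧-+ x (toℕ b))

  ⊗-⟦⟧ : ∀ x b → ⟦ x ⟧ ⊗ b ≡ ⟦ x * toℕ b ⟧
  ⊗-⟦⟧ x b = trans (cong (⟦ x ⟧ ⊗_) (sym (⟦toℕ⟧ b))) (⟦⟧-* x (toℕ b))

  ⊕-assoc : Associative _≡_ _⊕_
  ⊕-assoc a b c = begin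
    (a ⊕ b) ⊕ c                  ≡⟨ ⊕-⟦⟧ (toℕ a + toℕ b) c ⟩
    ⟦ toℕ a + toℕ b + toℕ c ⟧     ≡⟨ cong ⟦_⟧ (ℕ.+-assoc (toℕ a) (toℕ b) (toℕ c)) ⟩
    ⟦ toℕ a + (toℕ b + toℕ c) ⟧   ≡⟨ ⟦⟧-+ (toℕ a) (toℕ b + toℕ c) ⟨
    ⟦ toℕ a ⟧ ⊕ (b ⊕ c)           ≡⟨ cong (_⊕ (b ⊕ c)) (⟦toℕ⟧ a) ⟩
    a ⊕ (b ⊕ c)                  ∎
    where open ≡-Reasoning

  ⊕-comm : Commutative _≡_ _⊕_
  ⊕-comm a b = cong ⟦_⟧ (ℕ.+-comm (toℕ a) (toℕ b))

  ⊕-identityˡ : LeftIdentity _≡_ 0F _⊕_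
  ⊕-identityˡ a = trans (⊕-⟦⟧ 0 a) (⟦toℕ⟧ a)

  ⊗-assoc : Associative _≡_ _⊗_
  ⊗-assoc a b c = begin
    (a ⊗ b) ⊗ c                  ≡⟨ ⊗-⟦⟧ (toℕ a * toℕ b) c ⟩
    ⟦ toℕ a * toℕ b * toℕ c ⟧     ≡⟨ cong ⟦_⟧ (ℕ.*-assoc (toℕ a) (toℕ b) (toℕ c)) ⟩
    ⟦ toℕ a * (toℕ b * toℕ c) ⟧   ≡⟨ ⟦⟧-* (toℕ a) (toℕ b * toℕ c) ⟨
    ⟦ toℕ a ⟧ ⊗ (b ⊗ c)           ≡⟨ cong (_⊗ (b ⊗ c)) (⟦toℕ⟧ a) ⟩
    a ⊗ (b ⊗ c)                  ∎
    where open ≡-Reasoning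

  ⊗-comm : Commutative _≡_ _⊗_
  ⊗-comm a b = cong ⟦_⟧ (ℕ.*-comm (toℕ a) (toℕ b))

  ⊗-identityˡ : LeftIdentity _≡_ 1F _⊗_
  ⊗-identityˡ a = trans (⊗-⟦⟧ 1 a) (trans (cong ⟦_⟧ (ℕ.*-identityˡ (toℕ a))) (⟦toℕ⟧ a))

  ⊗-zeroˡ : LeftZero _≡_ 0F _⊗_
  ⊗-zeroˡ a = ⊗-⟦⟧ 0 a

  ⊗-distribʳ-⊕ : _DistributesOverʳ_ _≡_ _⊗_ _⊕_
  ⊗-distribʳ-⊕ a b c = begin
    (b ⊕ c) ⊗ a                        ≡⟨ ⊗-⟦⟧ (toℕ b + toℕ c) a ⟩
    ⟦ (toℕ b + toℕ c) * toℕ a ⟧         ≡⟨ cong ⟦_⟧ (ℕ.*-distribʳ-+ (toℕ a) (toℕ b) (toℕ c)) ⟩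
    ⟦ toℕ b * toℕ a + toℕ c * toℕ a ⟧   ≡⟨ ⟦⟧-+ (toℕ b * toℕ a) (toℕ c * toℕ a) ⟨
    (b ⊗ a) ⊕ (c ⊗ a)                  ∎
    where open ≡-Reasoning

  commutativeSemiring : CommutativeSemiring 0ℓ 0ℓ
  commutativeSemiring = record { isCommutativeSemiring = isCommutativeSemiringˡ record
    { +-isCommutativeMonoid = commutativeMonoid {e = 0F} ⊕-assoc ⊕-identityˡ ⊕-comm
    ; *-isCommutativeMonoid = commutativeMonoid {e = 1F} ⊗-assoc ⊗-identityˡ ⊗-comm
    ; distribʳ              = ⊗-distribʳ-⊕
    ; zeroˡ                 = ⊗-zeroˡ
    } }
    where
    open Biased (_≡_ {A = F})
    commutativeMonoid : ∀ {_∙_ e} → Associative _≡_ _∙_ → LeftIdentity _≡_ e _∙_ → Commutative _≡_ _∙_ →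
                        IsCommutativeMonoid _≡_ _∙_ e
    commutativeMonoid {_∙_} assoc identityˡ comm = isCommutativeMonoidˡ record
      { isSemigroup = record
        { isMagma = record { isEquivalence = isEquivalence ; ∙-cong = cong₂ _∙_ }
        ; assoc   = assoc
        }
      ; identityˡ   = identityˡ
      ; comm        = comm
      }

  open CommutativeSemiring commutativeSemiring public
    using () renaming (+-identityʳ to ⊕-identityʳ; *-identityʳ to ⊗-identityʳ; zeroʳ to ⊗-zeroʳ;
                       distribˡ to ⊗-distribˡ-⊕; +-monoid to ⊕-monoid)

  1⊕-1≡0 : 1F ⊕ -1F ≡ 0F
  1⊕-1≡0 = trans (⟦⟧-+ 1 (q ∸ 1)) (⟦⟧-cong (trans (cong (_% q) (ℕ.m+[n∸m]≡n (>-nonZero⁻¹ q))) ([m+n]%n≡m%n 0 q)))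

  SquaresToOne : F → Set
  SquaresToOne α = α ⊗ α ≡ 1F

  -1F-squaresToOne : SquaresToOne -1F
  -1F-squaresToOne = trans (⟦⟧-* (q ∸ 1) (q ∸ 1)) (⟦⟧-cong (pred²≡1 q))
    where
    expand : ∀ s → s * s + 1 * suc s ≡ 1 + s * suc s
    expand = solve-∀
    pred²≡1 : ∀ d .⦃ _ : NonZero d ⦄ → ((d ∸ 1) * (d ∸ 1)) % d ≡ 1 % d
    pred²≡1 (suc s) = begin
      (s * s) % suc s                ≡⟨ [m+kn]%n≡m%n (s * s) 1 (suc s) ⟨
      (s * s + 1 * suc s) % suc s    ≡⟨ cong (_% suc s) (expand s) ⟩
      (1 + s * suc s) % suc s        ≡⟨ [m+kn]%n≡m%n 1 s (suc s) ⟩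
      1 % suc s                      ∎
      where open ≡-Reasoning

  1F-squaresToOne : SquaresToOne 1F
  1F-squaresToOne = ⊗-identityˡ 1F

  ⊗-cancelʳ-squaresToOne : ∀ {α} a → SquaresToOne α → a ⊗ α ≡ 0F → a ≡ 0F
  ⊗-cancelʳ-squaresToOne {α} a α²≡1 aα≡0 = begin
    a             ≡⟨ ⊗-identityʳ a ⟨
    a ⊗ 1F        ≡⟨ cong (a ⊗_) α²≡1 ⟨
    a ⊗ (α ⊗ α)   ≡⟨ ⊗-assoc a α α ⟨
    (a ⊗ α) ⊗ α   ≡⟨ cong (_⊗ α) aα≡0 ⟩
    0F ⊗ α        ≡⟨ ⊗-zeroˡ α ⟩
    0F            ∎
    where open ≡-Reasoning

  ⊕-inverseʳ : ∀ z → z ⊕ (-1F ⊗ z) ≡ 0F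
  ⊕-inverseʳ z = begin
    z ⊕ (-1F ⊗ z)          ≡⟨ cong (_⊕ (-1F ⊗ z)) (⊗-identityˡ z) ⟨
    (1F ⊗ z) ⊕ (-1F ⊗ z)   ≡⟨ ⊗-distribʳ-⊕ z 1F -1F ⟨
    (1F ⊕ -1F) ⊗ z         ≡⟨ cong (_⊗ z) 1⊕-1≡0 ⟩
    0F ⊗ z                 ≡⟨ ⊗-zeroˡ z ⟩
    0F                     ∎
    where open ≡-Reasoning

  solve-squaresToOne : ∀ {α} → SquaresToOne α → ∀ β x y →
                       (α ⊗ ((α ⊗ x) ⊕ (β ⊗ y))) ⊕ ((-1F ⊗ (α ⊗ β)) ⊗ y) ≡ x
  solve-squaresToOne {α} α²≡1 β x y = begin
    (α ⊗ ((α ⊗ x) ⊕ (β ⊗ y))) ⊕ (γ ⊗ y)          ≡⟨ cong (_⊕ (γ ⊗ y)) (⊗-distribˡ-⊕ α (α ⊗ x) (β ⊗ y)) ⟩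
    ((α ⊗ (α ⊗ x)) ⊕ (α ⊗ (β ⊗ y))) ⊕ (γ ⊗ y)    ≡⟨ ⊕-assoc (α ⊗ (α ⊗ x)) (α ⊗ (β ⊗ y)) (γ ⊗ y) ⟩
    (α ⊗ (α ⊗ x)) ⊕ ((α ⊗ (β ⊗ y)) ⊕ (γ ⊗ y))    ≡⟨ cong₂ _⊕_ (⊗-assoc α α x) (cong (_⊕ (γ ⊗ y)) (⊗-assoc α β y)) ⟨
    ((α ⊗ α) ⊗ x) ⊕ (((α ⊗ β) ⊗ y) ⊕ (γ ⊗ y))    ≡⟨ cong₂ _⊕_ (cong (_⊗ x) α²≡1) (sym (⊗-distribʳ-⊕ y (α ⊗ β) γ)) ⟩
    (1F ⊗ x) ⊕ (((α ⊗ β) ⊕ γ) ⊗ y)               ≡⟨ cong₂ _⊕_ (⊗-identityˡ x) (cong (_⊗ y) (⊕-inverseʳ (α ⊗ β))) ⟩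
    x ⊕ (0F ⊗ y)                                 ≡⟨ cong (x ⊕_) (⊗-zeroˡ y) ⟩
    x ⊕ 0F                                       ≡⟨ ⊕-identityʳ x ⟩
    x                                            ∎
    where
    open ≡-Reasoning
    γ = -1F ⊗ (α ⊗ β)

  combination-pickˡ : ∀ a b {x y} → x ≡ 1F → y ≡ 0F → (a ⊗ x) ⊕ (b ⊗ y) ≡ a
  combination-pickˡ a b refl refl = trans (cong₂ _⊕_ (⊗-identityʳ a) (⊗-zeroʳ b)) (⊕-identityʳ a)

  combination-pickʳ : ∀ a b {x y} → x ≡ 0F → y ≡ 1F → (a ⊗ x) ⊕ (b ⊗ y) ≡ b
  combination-pickʳ a b refl refl = trans (cong₂ _⊕_ (⊗-zeroʳ a) (⊗-identityʳ b)) (⊕-identityˡ b)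

  combination-vanishes : ∀ a b {x y} → x ≡ 0F → y ≡ 0F → (a ⊗ x) ⊕ (b ⊗ y) ≡ 0F
  combination-vanishes a b refl refl = trans (cong₂ _⊕_ (⊗-zeroʳ a) (⊗-zeroʳ b)) (⊕-identityʳ 0F)

module LinearAlgebra (q : ℕ) ⦃ _ : NonZero q ⦄ (n : ℕ) where
  open Space q n
  open ModularArithmetic q
  open import Algebra.Properties.Monoid.Sum ⊕-monoid using (sum; sum-cong-≗; sum-replicate-zero)
  import Data.Fin as Fin
  open import Data.Fin.Properties using (suc-injective)
  open import Data.List using (List; []; _∷_; _++_; map)
  open import Data.List.Membership.Propositional using () renaming (_∈_ to _∈ₗ_)
  open import Data.List.Relation.Unary.All as All using (All; []; _∷_)
  open import Data.List.Relation.Unary.All.Properties using (++⁺; map⁺)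
  open import Data.List.Relation.Unary.Any using (here; there)
  open import Data.List.Relation.Unary.AllPairs using (AllPairs; []; _∷_)
  open import Data.Product using (map₁)
  open import Relation.Binary.PropositionalEquality using (_≢_)
  open import Relation.Nullary using (¬_)

  ≡⇒≈ : ∀ {x y} → x ≡ y → x ≈ y
  ≡⇒≈ refl v c = refl

  ≈-sym : ∀ {x y} → x ≈ y → y ≈ x
  ≈-sym x≈y v c = sym (x≈y v c)

  ≈-trans : ∀ {x y z} → x ≈ y → y ≈ z → x ≈ z
  ≈-trans x≈y y≈z v c = trans (x≈y v c) (y≈z v c)

  _at_ : Vect → Fin n × Colour → F
  x at (v , c) = x v c

  Span : (Vect → Set) → Vect → Set
  Span B x = ∃ λ (xs : List (F × Vect)) → All (λ p → B (proj₂ p)) xs × lincomb xs ≈ x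

  scale : F → List (F × Vect) → List (F × Vect)
  scale a = map (map₁ (a ⊗_))

  lincomb-++ : ∀ xs ys v c → lincomb (xs ++ ys) v c ≡ lincomb xs v c ⊕ lincomb ys v c
  lincomb-++ []             ys v c = sym (⊕-identityˡ _)
  lincomb-++ ((a , x) ∷ xs) ys v c =
    trans (cong ((a ⊗ x v c) ⊕_) (lincomb-++ xs ys v c)) (sym (⊕-assoc _ _ _))

  lincomb-scale : ∀ a xs v c → lincomb (scale a xs) v c ≡ a ⊗ lincomb xs v c
  lincomb-scale a []             v c = sym (⊗-zeroʳ a)
  lincomb-scale a ((b , x) ∷ xs) v c =
    trans (cong₂ _⊕_ (⊗-assoc a b (x v c)) (lincomb-scale a xs v c)) (sym (⊗-distribˡ-⊕ a _ _))

  ∑ : ∀ {k} → (Fin k → Vect) → Vect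
  ∑ f v c = sum (λ u → f u v c)

  sum-δ : ∀ {k} (t : Fin k → F) j → (∀ i → i ≢ j → t i ≡ 0F) → sum t ≡ t j
  sum-δ {suc k} t Fin.zero t≡0 = trans (cong (t Fin.zero ⊕_) sum-tail≡0) (⊕-identityʳ (t Fin.zero))
    where
    sum-tail≡0 : sum (t ∘ Fin.suc) ≡ 0F
    sum-tail≡0 = trans (sum-cong-≗ (λ i → t≡0 (Fin.suc i) λ ())) (sum-replicate-zero k)
  sum-δ {suc k} t (Fin.suc j) t≡0 = begin
    t Fin.zero ⊕ sum (t ∘ Fin.suc)   ≡⟨ cong (_⊕ sum (t ∘ Fin.suc)) (t≡0 Fin.zero λ ()) ⟩
    0F ⊕ sum (t ∘ Fin.suc)           ≡⟨ ⊕-identityˡ _ ⟩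
    sum (t ∘ Fin.suc)                ≡⟨ sum-δ (t ∘ Fin.suc) j (λ i i≢j → t≡0 (Fin.suc i) (i≢j ∘ suc-injective)) ⟩
    t (Fin.suc j)                    ∎
    where open ≡-Reasoning

  module _ {B : Vect → Set} where

    span-resp-≈ : ∀ {x y} → x ≈ y → Span B x → Span B y
    span-resp-≈ x≈y (xs , bs , xs≈x) = xs , bs , ≈-trans xs≈x x≈y

    span-∈ : ∀ {x} → B x → Span B x
    span-∈ {x} bx = (1F , x) ∷ [] , bx ∷ [] , λ v c → trans (⊕-identityʳ _) (⊗-identityˡ _)

    span-zero : ∀ {x} → x ≈ zeroV → Span B x
    span-zero x≈0 = [] , [] , ≈-sym x≈0

    span-+ : ∀ {x y} → Span B x → Span B y → Span B (x +V y)
    span-+ (xs , bs , xs≈x) (ys , cs , ys≈y) =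
      xs ++ ys , ++⁺ bs cs , λ v c → trans (lincomb-++ xs ys v c) (cong₂ _⊕_ (xs≈x v c) (ys≈y v c))

    span-· : ∀ a {x} → Span B x → Span B (a ·V x)
    span-· a (xs , bs , xs≈x) =
      scale a xs , map⁺ bs , λ v c → trans (lincomb-scale a xs v c) (cong (a ⊗_) (xs≈x v c))

    span-∑ : ∀ {k} (f : Fin k → Vect) → (∀ u → Span B (f u)) → Span B (∑ f)
    span-∑ {zero}  f spanned = span-zero λ _ _ → refl
    span-∑ {suc k} f spanned = span-+ (spanned Fin.zero) (span-∑ (f ∘ Fin.suc) (spanned ∘ Fin.suc))

    span-solve : ∀ {α β e x y} → SquaresToOne α → e ≈ ((α ·V x) +V (β ·V y)) →
                 Span B e → Span B y → Span B x
    span-solve {α} {β} {x = x} {y} α²≡1 e≈ spanned-e spanned-y =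
      span-resp-≈ (λ v c → trans (cong (λ z → (α ⊗ z) ⊕ ((-1F ⊗ (α ⊗ β)) ⊗ y v c)) (e≈ v c))
                                 (solve-squaresToOne {α} α²≡1 β (x v c) (y v c)))
                  (span-+ (span-· α spanned-e) (span-· (-1F ⊗ (α ⊗ β)) spanned-y))

  term : F × Vect → Fin n × Colour → F
  term (a , x) vc = a ⊗ (x at vc)

  Distinct : List (F × Vect) → Set
  Distinct = AllPairs (λ p p′ → ¬ (proj₂ p ≈ proj₂ p′))

  lincomb-vanishing : ∀ xs vc → (∀ {p} → p ∈ₗ xs → term p vc ≡ 0F) → lincomb xs at vc ≡ 0F
  lincomb-vanishing []       vc vanish = refl
  lincomb-vanishing (p ∷ xs) vc vanish =
    trans (cong₂ _⊕_ (vanish (here refl)) (lincomb-vanishing xs vc (vanish ∘ there))) (⊕-identityʳ 0F)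

  lincomb-isolated : ∀ {xs p} vc → Distinct xs → p ∈ₗ xs →
                   (∀ {p′} → p′ ∈ₗ xs → ¬ proj₂ p′ ≈ proj₂ p → term p′ vc ≡ 0F) →
                   lincomb xs at vc ≡ term p vc
  lincomb-isolated {p ∷ xs} vc (p≉xs ∷ _) (here refl) others = begin
    term p vc ⊕ (lincomb xs at vc)   ≡⟨ cong (term p vc ⊕_) (lincomb-vanishing xs vc rest-vanish) ⟩
    term p vc ⊕ 0F                   ≡⟨ ⊕-identityʳ _ ⟩
    term p vc                        ∎
    where
    open ≡-Reasoning
    rest-vanish : ∀ {p′} → p′ ∈ₗ xs → term p′ vc ≡ 0F
    rest-vanish p′∈ = others (there p′∈) (All.lookup p≉xs p′∈ ∘ ≈-sym)
  lincomb-isolated {h ∷ xs} {p} vc (h≉xs ∷ distinct) (there p∈) others = begin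
    term h vc ⊕ (lincomb xs at vc)   ≡⟨ cong (_⊕ (lincomb xs at vc)) (others (here refl) (All.lookup h≉xs p∈)) ⟩
    0F ⊕ (lincomb xs at vc)          ≡⟨ ⊕-identityˡ _ ⟩
    lincomb xs at vc                 ≡⟨ lincomb-isolated vc distinct p∈ (others ∘ there) ⟩
    term p vc                        ∎
    where open ≡-Reasoning

  record Triangular (B : Vect → Set) : Set where
    field
      height             : ∀ {x} → B x → ℕ
      pivot              : ∀ {x} → B x → Fin n × Colour
      pivot-squaresToOne : ∀ {x} (bx : B x) → SquaresToOne (x at pivot bx)
      vanishes-at-pivot  : ∀ {x y} (bx : B x) (by : B y) → ¬ y ≈ x →
                           y at pivot bx ≡ 0F ⊎ height by < height bx

  triangular⇒independent : ∀ {B} → Triangular B → Independent B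
  triangular⇒independent {B} triangular xs bs distinct xs≈0 =
    All.tabulate λ p∈ → vanish-below _ p∈ ℕ.≤-refl
    where
    open Triangular triangular
    vanish-below : ∀ k {p} (p∈ : p ∈ₗ xs) → height (All.lookup bs p∈) < k → proj₁ p ≡ 0F
    vanish-below (suc k) {a , x} p∈ (s≤s h≤k) =
      ⊗-cancelʳ-squaresToOne a (pivot-squaresToOne bx)
        (trans (sym (lincomb-isolated (pivot bx) distinct p∈ others)) (xs≈0 _ _))
      where
      bx = All.lookup bs p∈
      others : ∀ {p′} → p′ ∈ₗ xs → ¬ proj₂ p′ ≈ x → term p′ (pivot bx) ≡ 0F
      others {b , y} p′∈ y≉x with vanishes-at-pivot bx (All.lookup bs p′∈) y≉x
      ... | inj₁ y≡0  = trans (cong (b ⊗_) y≡0) (⊗-zeroʳ b)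
      ... | inj₂ lower = trans (cong (_⊗ (y at pivot bx)) (vanish-below k p′∈ (ℕ.≤-trans lower h≤k)))
                               (⊗-zeroˡ _)

  independent-⊆ : ∀ {B B′ : Vect → Set} → (∀ {x} → B x → B′ x) → Independent B′ → Independent B
  independent-⊆ B⊆B′ independent xs bs = independent xs (All.map B⊆B′ bs)

minimal-witness : ∀ {P : ℕ → Set} → Decidable P → ∀ {k} → P k → ∃ λ j → P j × (∀ {i} → P i → j ≤ i)
minimal-witness P? {zero}  p = 0 , p , λ _ → z≤n
minimal-witness P? {suc k} p with P? 0
... | yes p0 = 0 , p0 , λ _ → z≤n
... | no ¬p0 with minimal-witness (P? ∘ suc) p
...   | j , pj , least = suc j , pj , λ { {zero} p0 → contradiction p0 ¬p0 ; {suc i} pi → s≤s (least pi) }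

subsetOf : ∀ {k} {P : Fin k → Set} → Decidable P → Subset k
subsetOf P? = tabulate (does ∘ P?)

∈-subsetOf⁺ : ∀ {k} {P : Fin k → Set} (P? : Decidable P) {i} → P i → i ∈ subsetOf P?
∈-subsetOf⁺ P? {i} p = lookup⇒[]= i _ (trans (lookup∘tabulate _ i) (dec-true (P? i) p))

∈-subsetOf⁻ : ∀ {k} {P : Fin k → Set} (P? : Decidable P) {i} → i ∈ subsetOf P? → P i
∈-subsetOf⁻ P? {i} i∈ with P? i | trans (sym (lookup∘tabulate (does ∘ P?) i)) ([]=⇒lookup i∈)
... | yes p | _  = p
... | no _  | ()

module SpanningForests {n : ℕ} (G : Graph n) (T : Subset n) where
  open Graph G

  record ParentVia (rank : Fin n → ℕ) (v : Fin n) (i : Fin m) : Set where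
    field
      parent : Fin n
      joins  : SameEdge (ends i) (v , parent)
      closer : rank parent < rank v

  record SpanningForest : Set where
    field
      rank     : Fin n → ℕ
      parentOf : ∀ v → v ∈ T ⊎ (v ∉ T × ∃ (ParentVia rank v))

  WithinDistance : ℕ → Fin n → Set
  WithinDistance zero    v = v ∈ T
  WithinDistance (suc k) v = WithinDistance k v ⊎ ∃₂ λ i w → SameEdge (ends i) (v , w) × WithinDistance k w

  sameEdge? : ∀ (e e′ : Fin n × Fin n) → Dec (SameEdge e e′)
  sameEdge? (a , b) (c , d) = ((a ≟ c) ×-dec (b ≟ d)) ⊎-dec ((a ≟ d) ×-dec (b ≟ c))

  withinDistance? : ∀ k v → Dec (WithinDistance k v)
  withinDistance? zero    v = v ∈? T
  withinDistance? (suc k) v = withinDistance? k v ⊎-dec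
    any? λ i → any? λ w → sameEdge? (ends i) (v , w) ×-dec withinDistance? k w

  reach⇒withinDistance : ∀ {v t} → t ∈ T → Reach G v t → ∃ λ k → WithinDistance k v
  reach⇒withinDistance t∈T here = 0 , t∈T
  reach⇒withinDistance t∈T (fwd i r) = let k , near = reach⇒withinDistance t∈T r in
    suc k , inj₂ (i , proj₂ (ends i) , inj₁ (refl , refl) , near)
  reach⇒withinDistance t∈T (bwd i r) = let k , near = reach⇒withinDistance t∈T r in
    suc k , inj₂ (i , proj₁ (ends i) , inj₂ (refl , refl) , near)

  spanningForest : Connected G → ∃ (_∈ T) → SpanningForest
  spanningForest connected (t , t∈T) = record { rank = rank ; parentOf = parentOf }
    where
    distance : ∀ v → ∃ λ j → WithinDistance j v × (∀ {i} → WithinDistance i v → j ≤ i)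
    distance v = minimal-witness (λ k → withinDistance? k v) (proj₂ (reach⇒withinDistance t∈T (connected v t)))

    rank : Fin n → ℕ
    rank v = proj₁ (distance v)

    rank-minimal : ∀ {w i} → WithinDistance i w → rank w ≤ i
    rank-minimal {w} = proj₂ (proj₂ (distance w))

    descend : ∀ {v j} → v ∉ T → WithinDistance j v → (∀ {i} → WithinDistance i v → j ≤ i) →
              ∃₂ λ i w → SameEdge (ends i) (v , w) × rank w < j
    descend {j = zero}  v∉T v∈T              _     = contradiction v∈T v∉T
    descend {j = suc j} v∉T (inj₁ near)      least = contradiction (least near) (ℕ.n≮n j)
    descend {j = suc j} v∉T (inj₂ (i , w , joins , near)) _ = i , w , joins , s≤s (rank-minimal near)

    parentOf : ∀ v → v ∈ T ⊎ (v ∉ T × ∃ (ParentVia rank v))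
    parentOf v with v ∈? T
    ... | yes v∈T = inj₁ v∈T
    ... | no  v∉T = let i , w , joins , closer = descend v∉T (proj₁ (proj₂ (distance v))) rank-minimal
                    in inj₂ (v∉T , i , record { parent = w ; joins = joins ; closer = closer })

module EdgeVectors (q : ℕ) ⦃ _ : NonZero q ⦄ {n : ℕ} (G : Graph n) (T : Subset n)
                   (θ : Fin n → Fin q) (σ : Fin (Graph.m G) → Bool) where
  open Graph G
  open Space q n
  open Edges G T θ σ
  open ModularArithmetic q
  open LinearAlgebra q n using (≡⇒≈)
  open import Data.Bool using (true; false; if_then_else_)
  open import Data.Bool.Properties using (¬-not)
  open import Relation.Binary.PropositionalEquality using (_≢_; subst)

  _≟ᶜ_ : (c d : Colour) → Dec (c ≡ d)
  ∘c ≟ᶜ ∘c = yes refl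
  ∘c ≟ᶜ •c = no λ ()
  •c ≟ᶜ ∘c = no λ ()
  •c ≟ᶜ •c = yes refl

  unit-diagonal : ∀ v c → unit v c v c ≡ 1F
  unit-diagonal v ∘c with v ≟ v
  ... | yes _   = refl
  ... | no v≢v = contradiction refl v≢v
  unit-diagonal v •c with v ≟ v
  ... | yes _   = refl
  ... | no v≢v = contradiction refl v≢v

  unit-off : ∀ {u v} c d → u ≢ v → unit u c v d ≡ 0F
  unit-off {u} {v} c d u≢v with u ≟ v
  ... | yes u≡v = contradiction u≡v u≢v
  ... | no _    = refl

  unit-offᶜ : ∀ u v {c d} → c ≢ d → unit u c v d ≡ 0F
  unit-offᶜ u v {∘c} {∘c} c≢d = contradiction refl c≢d
  unit-offᶜ u v {•c} {•c} c≢d = contradiction refl c≢d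
  unit-offᶜ u v {∘c} {•c} _ with u ≟ v
  ... | yes _ = refl
  ... | no  _ = refl
  unit-offᶜ u v {•c} {∘c} _ with u ≟ v
  ... | yes _ = refl
  ... | no  _ = refl

  vbul-terminal : ∀ {v} → v ∈ T → vbul T θ v ≡ θ v ·V unit v ∘c
  vbul-terminal {v} v∈T = cong (λ b → if b then θ v ·V unit v ∘c else unit v •c) ([]=⇒lookup v∈T)

  vbul-nonterminal : ∀ {v} → v ∉ T → vbul T θ v ≡ unit v •c
  vbul-nonterminal {v} v∉T =
    cong (λ b → if b then θ v ·V unit v ∘c else unit v •c) (¬-not (v∉T ∘ lookup⇒[]= v T))

  vertexVec : Colour → Fin n → Vect
  vertexVec ∘c = vcirc
  vertexVec •c = vbul T θ

  edgeVec : Colour → Fin m → Vect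
  edgeVec ∘c = ecirc
  edgeVec •c = ebul

  edgeVec-ends : ∀ c i →
                 edgeVec c i ≡ (μ₁ i ·V vertexVec c (proj₁ (ends i))) +V (μ₂ i ·V vertexVec c (proj₂ (ends i)))
  edgeVec-ends ∘c i = refl
  edgeVec-ends •c i = refl

  vertexVec-off : ∀ c {u v} d → u ≢ v → vertexVec c u v d ≡ 0F
  vertexVec-off ∘c d u≢v = unit-off ∘c d u≢v
  vertexVec-off •c {u} {v} d u≢v with u ∈? T
  ... | yes u∈T = trans (≡⇒≈ (vbul-terminal u∈T) v d) (trans (cong (θ u ⊗_) (unit-off ∘c d u≢v)) (⊗-zeroʳ (θ u)))
  ... | no  u∉T = trans (≡⇒≈ (vbul-nonterminal u∉T) v d) (unit-off •c d u≢v)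

  vertexVec-nonterminal : ∀ c u {v} d → v ∉ T → vertexVec c u v d ≡ unit u c v d
  vertexVec-nonterminal ∘c u d v∉T = refl
  vertexVec-nonterminal •c u {v} d v∉T with u ∈? T
  ... | yes u∈T = trans (vertexVec-off •c d u≢v) (sym (unit-off •c d u≢v))
    where
    u≢v : u ≢ v
    u≢v refl = v∉T u∈T
  ... | no  u∉T = ≡⇒≈ (vbul-nonterminal u∉T) v d

  vertexVec-terminal : ∀ c u {t} → t ∈ T → vertexVec c u t •c ≡ 0F
  vertexVec-terminal ∘c u {t} t∈T = unit-offᶜ u t λ ()
  vertexVec-terminal •c u {t} t∈T with u ∈? T
  ... | yes u∈T = trans (≡⇒≈ (vbul-terminal u∈T) t •c) (trans (cong (θ u ⊗_) (unit-offᶜ u t λ ())) (⊗-zeroʳ (θ u)))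
  ... | no  u∉T = trans (≡⇒≈ (vbul-nonterminal u∉T) t •c) (unit-off {u} {t} •c •c λ { refl → u∉T t∈T })

  μ₁-squaresToOne : ∀ i → SquaresToOne (μ₁ i)
  μ₁-squaresToOne i with σ i
  ... | true  = 1F-squaresToOne
  ... | false = -1F-squaresToOne

  μ₂-squaresToOne : ∀ i → SquaresToOne (μ₂ i)
  μ₂-squaresToOne i with σ i
  ... | true  = -1F-squaresToOne
  ... | false = 1F-squaresToOne

  edgeVec-joins : ∀ c {i a b} → SameEdge (ends i) (a , b) →
                  ∃₂ λ α β → SquaresToOne α × edgeVec c i ≈ ((α ·V vertexVec c a) +V (β ·V vertexVec c b))
  edgeVec-joins c {i} (inj₁ (refl , refl)) =
    μ₁ i , μ₂ i , μ₁-squaresToOne i , ≡⇒≈ (edgeVec-ends c i)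
  edgeVec-joins c {i} (inj₂ (refl , refl)) =
    μ₂ i , μ₁ i , μ₂-squaresToOne i , λ v d → trans (≡⇒≈ (edgeVec-ends c i) v d)
      (⊕-comm (μ₁ i ⊗ vertexVec c (proj₁ (ends i)) v d) (μ₂ i ⊗ vertexVec c (proj₂ (ends i)) v d))

  edgeVec-off : ∀ c {i a b v} d → SameEdge (ends i) (a , b) → a ≢ v → b ≢ v → edgeVec c i v d ≡ 0F
  edgeVec-off c {v = v} d joins a≢v b≢v =
    let α , β , _ , e≈ = edgeVec-joins c joins
    in trans (e≈ v d) (combination-vanishes α β (vertexVec-off c d a≢v) (vertexVec-off c d b≢v))

  edgeVec-offᶜ : ∀ {c d} i {v} → v ∉ T → c ≢ d → edgeVec c i v d ≡ 0F
  edgeVec-offᶜ {c} {d} i {v} v∉T c≢d = trans (≡⇒≈ (edgeVec-ends c i) v d)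
    (combination-vanishes (μ₁ i) (μ₂ i) (vanishes (proj₁ (ends i))) (vanishes (proj₂ (ends i))))
    where
    vanishes : ∀ u → vertexVec c u v d ≡ 0F
    vanishes u = trans (vertexVec-nonterminal c u d v∉T) (unit-offᶜ u v c≢d)

  edgeVec-terminal : ∀ c i {t} → t ∈ T → edgeVec c i t •c ≡ 0F
  edgeVec-terminal c i {t} t∈T = trans (≡⇒≈ (edgeVec-ends c i) t •c)
    (combination-vanishes (μ₁ i) (μ₂ i) (vertexVec-terminal c _ t∈T) (vertexVec-terminal c _ t∈T))

  edgeVec-at-end : ∀ c {i v w} → v ∉ T → SameEdge (ends i) (v , w) → w ≢ v → SquaresToOne (edgeVec c i v c)
  edgeVec-at-end c {v = v} v∉T joins w≢v =
    let α , β , α²≡1 , e≈ = edgeVec-joins c joins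
        v-coordinate = trans (vertexVec-nonterminal c v c v∉T) (unit-diagonal v c)
    in subst SquaresToOne (sym (trans (e≈ v c) (combination-pickˡ α β v-coordinate (vertexVec-off c c w≢v)))) α²≡1


module FeasibleBasis (q : ℕ) ⦃ _ : NonZero q ⦄ {n : ℕ} (G : Graph n) (T : Subset n)
                     (θ : Fin n → Fin q) (σ : Fin (Graph.m G) → Bool)
                     (forest : SpanningForests.SpanningForest G T) where
  open Graph G
  open Space q n
  open Edges G T θ σ
  open ModularArithmetic q
  open LinearAlgebra q n
  open EdgeVectors q G T θ σ
  open SpanningForests G T
  open SpanningForest forest
  open ParentVia
  open import Data.List using (map; allFin)
  open import Data.List.Extrema.Nat using (max; xs≤max)
  open import Data.List.Membership.Propositional.Properties using (∈-map⁺; ∈-allFin)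
  import Data.List.Relation.Unary.All as All
  open import Data.Nat.Induction using (<-wellFounded)
  open import Data.Product using (Σ)
  open import Data.Sum using (map₂)
  open import Data.Sum.Properties using (inj₂-injective)
  open import Induction.WellFounded as WF using ()
  import Relation.Binary.Construct.On as On
  open import Relation.Binary.PropositionalEquality using (_≢_; subst)
  open import Relation.Nullary using (¬_)

  IsParentEdge : Fin m → Fin n → Set
  IsParentEdge i v = Σ (v ∉ T) λ v∉T → Σ (ParentVia rank v i) λ pv → parentOf v ≡ inj₂ (v∉T , i , pv)

  isParentEdge? : ∀ i v → Dec (IsParentEdge i v)
  isParentEdge? i v with parentOf v
  ... | inj₁ _             = no λ { (_ , _ , ()) }
  ... | inj₂ (v∉T , j , pv) with j ≟ i
  ...   | yes refl = yes (v∉T , pv , refl)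
  ...   | no  j≢i  = no λ { (_ , _ , refl) → j≢i refl }

  parentEdge-unique : ∀ {i j v} → IsParentEdge i v → IsParentEdge j v → i ≡ j
  parentEdge-unique (_ , _ , eq) (_ , _ , eq′) = cong (proj₁ ∘ proj₂) (inj₂-injective (trans (sym eq) eq′))

  parent≢ : ∀ {v i} (pv : ParentVia rank v i) → parent pv ≢ v
  parent≢ pv refl = ℕ.<-irrefl refl (closer pv)

  forestEdges : Subset m
  forestEdges = subsetOf (λ i → any? (isParentEdge? i))

  child : ∀ {i} → i ∈ forestEdges → ∃ (IsParentEdge i)
  child = ∈-subsetOf⁻ (λ i → any? (isParentEdge? i))

  B : Vect → Set
  B = FeasibleSet T forestEdges

  edgeVec∈B : ∀ c {i} → i ∈ forestEdges → B (edgeVec c i)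
  edgeVec∈B ∘c i∈ = inj₂ (_ , i∈ , inj₁ λ _ _ → refl)
  edgeVec∈B •c i∈ = inj₂ (_ , i∈ , inj₂ λ _ _ → refl)

  BasisVector : Vect → Set
  BasisVector x = (∃ λ t → t ∈ T × x ≈ sing t) ⊎ (∃₂ λ c i → i ∈ forestEdges × x ≈ edgeVec c i)

  basisVector : ∀ {x} → B x → BasisVector x
  basisVector (inj₁ singleton)          = inj₁ singleton
  basisVector (inj₂ (i , i∈ , inj₁ x≈)) = inj₂ (∘c , i , i∈ , x≈)
  basisVector (inj₂ (i , i∈ , inj₂ x≈)) = inj₂ (•c , i , i∈ , x≈)

  B⊆W : ∀ x → B x → InW T x
  B⊆W x bx t t∈T with basisVector bx
  ... | inj₁ (u , _ , x≈)     = trans (x≈ t •c) (unit-offᶜ u t λ ())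
  ... | inj₂ (c , i , _ , x≈) = trans (x≈ t •c) (edgeVec-terminal c i t∈T)

  N : ℕ
  N = max 0 (map rank (allFin n))

  rank≤N : ∀ v → rank v ≤ N
  rank≤N v = All.lookup (xs≤max 0 (map rank (allFin n))) (∈-map⁺ rank (∈-allFin v))

  edge-vanishes-at-child : ∀ {c c′ i j v v′ y} → IsParentEdge i v → IsParentEdge j v′ →
                           y ≈ edgeVec c′ j → ¬ y ≈ edgeVec c i → y v c ≡ 0F ⊎ rank v < rank v′
  edge-vanishes-at-child {c} {c′} {v = v} {v′} pe@(v∉T , _) pe′@(_ , pv′ , _) y≈ y≉ with v′ ≟ v
  ... | yes refl with parentEdge-unique pe pe′ | c′ ≟ᶜ c
  ...   | refl | yes refl = contradiction y≈ y≉
  ...   | refl | no c′≢c  = inj₁ (trans (y≈ v c) (edgeVec-offᶜ _ v∉T c′≢c))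
  edge-vanishes-at-child {c} {c′} {v = v} {v′} pe pe′@(_ , pv′ , _) y≈ y≉ | no v′≢v with parent pv′ ≟ v
  ... | yes refl = inj₂ (closer pv′)
  ... | no p′≢v  = inj₁ (trans (y≈ v c) (edgeVec-off c′ c (joins pv′) v′≢v p′≢v))

  triangular : Triangular BasisVector
  triangular = record
    { height             = height
    ; pivot              = pivot
    ; pivot-squaresToOne = pivot-squaresToOne
    ; vanishes-at-pivot  = vanishes-at-pivot
    }
    where
    -- N bounds every rank, so N ∸ rank does not truncate and decreases from parent to child.
    height : ∀ {x} → BasisVector x → ℕ
    height (inj₁ _)                = suc N
    height (inj₂ (_ , _ , i∈ , _)) = N ∸ rank (proj₁ (child i∈))

    pivot : ∀ {x} → BasisVector x → Fin n × Colour
    pivot (inj₁ (t , _))          = t , ∘c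
    pivot (inj₂ (c , _ , i∈ , _)) = proj₁ (child i∈) , c

    pivot-squaresToOne : ∀ {x} (mx : BasisVector x) → SquaresToOne (x at pivot mx)
    pivot-squaresToOne (inj₁ (t , _ , x≈)) =
      subst SquaresToOne (sym (trans (x≈ t ∘c) (unit-diagonal t ∘c))) 1F-squaresToOne
    pivot-squaresToOne (inj₂ (c , i , i∈ , x≈)) with child i∈
    ... | v , v∉T , pv , _ = subst SquaresToOne (sym (x≈ v c)) (edgeVec-at-end c v∉T (joins pv) (parent≢ pv))

    vanishes-at-pivot : ∀ {x y} (mx : BasisVector x) (my : BasisVector y) → ¬ y ≈ x →
                        y at pivot mx ≡ 0F ⊎ height my < height mx
    vanishes-at-pivot (inj₁ (t , _ , x≈)) (inj₁ (t′ , _ , y≈)) y≉x with t′ ≟ t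
    ... | yes refl = contradiction (≈-trans y≈ (≈-sym x≈)) y≉x
    ... | no t′≢t  = inj₁ (trans (y≈ t ∘c) (unit-off ∘c ∘c t′≢t))
    vanishes-at-pivot (inj₁ _) (inj₂ (_ , _ , j∈ , _)) _ = inj₂ (s≤s (ℕ.m∸n≤m N (rank (proj₁ (child j∈)))))
    vanishes-at-pivot (inj₂ (c , i , i∈ , _)) (inj₁ (t , t∈T , y≈)) _ with child i∈
    ... | v , v∉T , _ = inj₁ (trans (y≈ v c) (unit-off {t} {v} ∘c c λ { refl → v∉T t∈T }))
    vanishes-at-pivot (inj₂ (c , i , i∈ , x≈)) (inj₂ (c′ , j , j∈ , y≈)) y≉x with child i∈ | child j∈
    ... | v , pe | v′ , pe′ =
      map₂ (λ lower → ℕ.∸-monoʳ-< lower (rank≤N v′))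
           (edge-vanishes-at-child {c′ = c′} pe pe′ y≈ (λ y≈e → y≉x (≈-trans y≈e (≈-sym x≈))))

  independent : Independent B
  independent = independent-⊆ basisVector (triangular⇒independent triangular)

  terminal-spanned : ∀ c {v} → v ∈ T → Span B (vertexVec c v)
  terminal-spanned ∘c {v} v∈T = span-∈ (inj₁ (v , v∈T , λ _ _ → refl))
  terminal-spanned •c {v} v∈T =
    span-resp-≈ (≡⇒≈ (sym (vbul-terminal v∈T))) (span-· (θ v) (terminal-spanned ∘c v∈T))

  vertexVec-spanned : ∀ c v → Span B (vertexVec c v)
  vertexVec-spanned c = WF.All.wfRec (On.wellFounded rank <-wellFounded) 0ℓ (Span B ∘ vertexVec c) spanned
    where
    spanned : ∀ v → (∀ {w} → rank w < rank v → Span B (vertexVec c w)) → Span B (vertexVec c v)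
    spanned v lower with parentOf v in eq
    ... | inj₁ v∈T            = terminal-spanned c v∈T
    ... | inj₂ (v∉T , i , pv) =
      let α , β , α²≡1 , e≈ = edgeVec-joins c (joins pv)
          i∈ = ∈-subsetOf⁺ (λ i → any? (isParentEdge? i)) (v , v∉T , pv , eq)
      in span-solve {α = α} {β} α²≡1 e≈ (span-∈ (edgeVec∈B c i∈)) (lower (closer pv))

  standard-decomposition : ∀ x → x ≈ ∑ (λ u → (x u ∘c ·V unit u ∘c) +V (x u •c ·V unit u •c))
  standard-decomposition x v d = sym (trans (sum-δ _ v off-diagonal) (diagonal d))
    where
    off-diagonal : ∀ u → u ≢ v → (x u ∘c ⊗ unit u ∘c v d) ⊕ (x u •c ⊗ unit u •c v d) ≡ 0F
    off-diagonal u u≢v = combination-vanishes (x u ∘c) (x u •c) (unit-off ∘c d u≢v) (unit-off •c d u≢v)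
    diagonal : ∀ d → (x v ∘c ⊗ unit v ∘c v d) ⊕ (x v •c ⊗ unit v •c v d) ≡ x v d
    diagonal ∘c = combination-pickˡ (x v ∘c) (x v •c) (unit-diagonal v ∘c) (unit-offᶜ v v {•c} λ ())
    diagonal •c = combination-pickʳ (x v ∘c) (x v •c) (unit-offᶜ v v {∘c} λ ()) (unit-diagonal v •c)

  spans : Spans T B
  spans x x∈W = span-resp-≈ (≈-sym (standard-decomposition x))
    (span-∑ _ λ u → span-+ (span-· (x u ∘c) (vertexVec-spanned ∘c u)) (bullet-spanned u))
    where
    bullet-spanned : ∀ u → Span B (x u •c ·V unit u •c)
    bullet-spanned u with u ∈? T
    ... | yes u∈T = span-zero λ v d → trans (cong (_⊗ unit u •c v d) (x∈W u u∈T)) (⊗-zeroˡ _)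
    ... | no  u∉T =
      subst (Span B ∘ (x u •c ·V_)) (vbul-nonterminal u∉T) (span-· (x u •c) (vertexVec-spanned •c u))

  isBasis : IsBasisOfW T B
  isBasis = B⊆W , independent , spans

lemma2 : (n : ℕ) (G : Graph n) → Connected G
    → (T : Subset n)
    → (p : ℕ) → 2 ≤ p → (blk : Fin n → Fin p)
    → (∀ b → ∃ λ t → t ∈ T × blk t ≡ b)
    → (q : ℕ) ⦃ _ : NonZero q ⦄ → Prime q → p < q → q ≤ 2 * p
    → (∀ r → Prime r → p < r → q ≤ r)
    → (θ : Fin n → Fin q)
    → (∀ t t' → t ∈ T → t' ∈ T → (θ t ≡ θ t' ⇔ blk t ≡ blk t'))
    → (σ : Fin (Graph.m G) → Bool)
    → ∃₂ λ (S : Subset n) (Fs : Subset (Graph.m G)) → S ⊆ T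
      × Space.IsBasisOfW q n T (Space.Edges.FeasibleSet q n G T θ σ S Fs)
      × (∀ t → t ∈ T → Space.Edges.FeasibleSet q n G T θ σ S Fs (Space.sing q n t))
lemma2 n G connected T p 2≤p blk blk-onto q _ _ _ _ θ _ σ =
  T , forestEdges , (λ t∈T → t∈T) , isBasis , λ t t∈T → inj₁ (t , t∈T , λ _ _ → refl)
  where
  terminal : ∃ (_∈ T)
  terminal = let t , t∈T , _ = blk-onto (fromℕ< (ℕ.≤-trans (s≤s z≤n) 2≤p)) in t , t∈T
  open FeasibleBasis q G T θ σ (SpanningForests.spanningForest G T connected terminal)
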